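{- Let $G=(S,B,E)$ be a bipartite graph with a fixed arrival order of the buyers, let $j \in S$, and let $G_{ -j}$ be the graph obtained from $G$ by deleting the vertex $j$ (with the same arrival order of buyers). Fix values $x \in [0, 1]^S$. Let $M$ be the matching produced by \textsc{Ranking} (rank version) on $G$ with ranks $x$, and let $M_{ -j}$ be the matching produced by \textsc{Ranking} on $G_{ -j}$ with ranks $(x_{j'})_{j'\in S\setminus\{j\}}$. Then $|M_{ -j}| \leq |M| \leq |M_{ -j}| + 1$.
   Context: \textsc{Ranking} (rank version): each seller $j\in S$ has a rank $x_j\in[0,1]$; buyers arrive one at a time in the given order, and when buyer $i$ arrives it is matched to an unmatched seller $j\in N(i)$ minimizing $x_j$, if any unmatched neighbor exists (ties broken by a fixed total order on $S$).
   Formalization: The ranks $x_j$ are rational numbers in [0,1] rather than real numbers in [0,1]. -}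

module Defs where

open import Data.Nat using (ℕ; zero; suc)
open import Data.Bool using (Bool; true; false; if_then_else_; not; _∧_)
open import Data.Fin using (Fin; punchIn; _≟_)
open import Data.List using (List; []; _∷_; foldl)
open import Data.Maybe using (Maybe; just; nothing)
open import Data.Product using (_×_; _,_)
open import Data.Rational using (ℚ; _<?_)
open import Relation.Nullary.Decidable using (does)
open import Data.List.Base using (allFin)

-- A bipartite graph G = (S, B, E) with sellers S = Fin s and buyers B = Fin b.
-- E i j = true iff buyer i is adjacent to seller j.
-- The fixed arrival order of buyers is the index order 0, 1, …, b-1
-- (any fixed arrival order is this one after relabelling buyers).
-- The fixed tie-breaking total order on S is the index order of Fin s.
Graph : ℕ → ℕ → Set
Graph s b = Fin b → Fin s → Bool

-- Ranks: x : Fin s → ℚ (constrained to [0,1] in the statement).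

-- Among sellers k with avail k = true, pick one minimising x k, ties broken
-- towards the smaller index.
private
  pick : ∀ {s} → (Fin s → ℚ) → (Fin s → Bool) → Maybe (Fin s) → Fin s → Maybe (Fin s)
  pick x avail cur k with avail k
  ... | false = cur
  ... | true with cur
  ...   | nothing = just k
  ...   | just c = if does (x k <? x c) then just k else just c

bestSeller : ∀ {s} → (Fin s → ℚ) → (Fin s → Bool) → Maybe (Fin s)
bestSeller {s} x avail = foldl (pick x avail) nothing (allFin s)

private
  markMatched : ∀ {s} → (Fin s → Bool) → Fin s → (Fin s → Bool)
  markMatched m k k' = if does (k ≟ k') then true else m k'

  run : ∀ {s b} → Graph s b → (Fin s → ℚ) → (Fin s → Bool) → List (Fin b) → List (Fin b × Fin s)
  run G x m [] = []
  run G x m (i ∷ is) with bestSeller x (λ k → G i k ∧ not (m k))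
  ... | nothing = run G x m is
  ... | just k = (i , k) ∷ run G x (markMatched m k) is

ranking : ∀ {s b} → Graph s b → (Fin s → ℚ) → List (Fin b × Fin s)
ranking {s} {b} G x = run G x (λ _ → false) (allFin b)

-- G_{-j}: delete seller j.  Remaining sellers are Fin n, embedded into Fin (suc n)
-- by the order-preserving map punchIn j (so the tie-break order is the restriction).
deleteSeller : ∀ {n b} → Graph (suc n) b → Fin (suc n) → Graph n b
deleteSeller G j i k = G i (punchIn j k)

deleteRank : ∀ {n} → (Fin (suc n) → ℚ) → Fin (suc n) → (Fin n → ℚ)
deleteRank x j k = x (punchIn j k)

{-# OPTIONS --safe #-}
module Submission where

-- Ranking on G₋ⱼ behaves exactly like Ranking on G started with j already matched. So it
-- suffices to compare two runs of Ranking on one graph whose initial sets of matched sellers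
-- differ only in a seller u, matched in the second run but not in the first. Buyer by buyer
-- this situation persists: both runs pick the same seller unless the first one picks u, and
-- then the second picks either another seller u′, which becomes the new difference, or
-- nothing, after which the two runs coincide. Hence the first run matches at least as many
-- buyers as the second, and at most one more.

open import Defs
open import Data.Nat using (ℕ; suc; _≤_; _+_)
open import Data.Fin using (Fin)
open import Data.List using (length)
open import Data.Product using (_×_)
open import Data.Rational using (ℚ; 0ℚ; 1ℚ) renaming (_≤_ to _≤ℚ_)

open import Data.Bool using (Bool; true; false; _∧_; not; if_then_else_)
open import Data.Bool.Properties using (¬-not; ∧-zeroʳ)
open import Data.Empty using (⊥-elim)
open import Data.Fin using (zero; suc; toℕ; punchIn; punchOut; _≟_) renaming (_≤_ to _≤ᶠ_)
open import Data.Fin.Properties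
  using (toℕ<n; punchIn-injective; punchIn-mono-≤; punchInᵢ≢i; punchIn-punchOut)
import Data.Fin.Properties as Fin
open import Data.List using (List; []; _∷_; foldl; allFin; tabulate; map)
open import Data.List.Properties using (length-map)
open import Data.Maybe using (Maybe; just; nothing) renaming (map to mapMaybe)
open import Data.Nat using (_<_; z≤n; s≤s)
import Data.Nat as ℕ
import Data.Nat.Properties as ℕ
open import Data.Product using (_,_; proj₁; proj₂; map₂)
open import Data.Rational using (_<?_) renaming (_<_ to _<ℚ_)
import Data.Rational.Properties as ℚ
open import Data.Sum using (_⊎_; inj₁; inj₂)
open import Function using (_∘_; const; id)
open import Relation.Nullary using (yes; no)
open import Relation.Nullary.Decidable using (does; dec-true; dec-false)
open import Relation.Binary.PropositionalEquality

private
  variable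
    s b n : ℕ

true≢false : true ≢ false
true≢false ()

Precedes : (Fin s → ℚ) → Fin s → Fin s → Set
Precedes x c k = x c <ℚ x k ⊎ (x c ≤ℚ x k × c ≤ᶠ k)

IsBest : (Fin s → ℚ) → (Fin s → Bool) → Fin s → Set
IsBest x avail c = avail c ≡ true × (∀ k → avail k ≡ true → Precedes x c k)

Selects : (Fin s → ℚ) → (Fin s → Bool) → Maybe (Fin s) → Set
Selects x avail nothing  = ∀ k → avail k ≡ false
Selects x avail (just c) = IsBest x avail c

Precedes-refl : ∀ (x : Fin s → ℚ) c → Precedes x c c
Precedes-refl x c = inj₂ (ℚ.≤-refl , Fin.≤-refl)

Precedes-antisym : ∀ {x : Fin s → ℚ} {c d} → Precedes x c d → Precedes x d c → c ≡ d
Precedes-antisym (inj₁ p) (inj₁ q) = ⊥-elim (ℚ.<-asym p q)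
Precedes-antisym (inj₁ p) (inj₂ (q , _)) = ⊥-elim (ℚ.<-irrefl refl (ℚ.<-≤-trans p q))
Precedes-antisym (inj₂ (q , _)) (inj₁ p) = ⊥-elim (ℚ.<-irrefl refl (ℚ.<-≤-trans p q))
Precedes-antisym (inj₂ (_ , p)) (inj₂ (_ , q)) = Fin.≤-antisym p q

<-Precedes-trans : ∀ {x : Fin s → ℚ} {c d k} → x c <ℚ x d → Precedes x d k → Precedes x c k
<-Precedes-trans p (inj₁ q) = inj₁ (ℚ.<-trans p q)
<-Precedes-trans p (inj₂ (q , _)) = inj₁ (ℚ.<-≤-trans p q)

Selects-unique : ∀ {x : Fin s → ℚ} {avail} r r' → Selects x avail r → Selects x avail r' → r ≡ r'
Selects-unique nothing nothing _ _ = refl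
Selects-unique nothing (just c) none (ac , _) = ⊥-elim (true≢false (trans (sym ac) (none c)))
Selects-unique (just c) nothing (ac , _) none = ⊥-elim (true≢false (trans (sym ac) (none c)))
Selects-unique (just c) (just d) (ac , c-best) (ad , d-best) =
  cong just (Precedes-antisym (c-best d ad) (d-best c ac))

-- The step function of bestSeller is private to Defs; unification recovers it, so that
-- select x avail computes exactly like it.
select : (Fin s → ℚ) → (Fin s → Bool) → Maybe (Fin s) → Fin s → Maybe (Fin s)
select {s} x avail = step
  where
  step : Maybe (Fin s) → Fin s → Maybe (Fin s)
  step = _
  unfolds-bestSeller : bestSeller x avail ≡ foldl step nothing (allFin s)
  unfolds-bestSeller = refl

SelectsBelow : ℕ → (Fin s → ℚ) → (Fin s → Bool) → Maybe (Fin s) → Set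
SelectsBelow lo x avail nothing  = ∀ k → toℕ k < lo → avail k ≡ false
SelectsBelow lo x avail (just c) =
  toℕ c < lo × avail c ≡ true × (∀ k → toℕ k < lo → avail k ≡ true → Precedes x c k)

below-suc : ∀ {lo} {k k' : Fin s} → toℕ k ≡ lo → toℕ k' < suc lo → toℕ k' < lo ⊎ k' ≡ k
below-suc k≡lo k'<1+lo with ℕ.m<1+n⇒m<n∨m≡n k'<1+lo
... | inj₁ k'<lo = inj₁ k'<lo
... | inj₂ k'≡lo = inj₂ (Fin.toℕ-injective (trans k'≡lo (sym k≡lo)))

module _ {x : Fin s → ℚ} {avail : Fin s → Bool} {lo : ℕ} {k : Fin s} (k≡lo : toℕ k ≡ lo) where

  SelectsBelow-skip : avail k ≡ false → ∀ r → SelectsBelow lo x avail r → SelectsBelow (suc lo) x avail r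
  SelectsBelow-skip ak nothing none k' k'<1+lo with below-suc k≡lo k'<1+lo
  ... | inj₁ k'<lo = none k' k'<lo
  ... | inj₂ refl = ak
  SelectsBelow-skip ak (just c) (c<lo , ac , best) = ℕ.m<n⇒m<1+n c<lo , ac , best′
    where
    best′ : ∀ k' → toℕ k' < suc lo → avail k' ≡ true → Precedes x c k'
    best′ k' k'<1+lo ak' with below-suc k≡lo k'<1+lo
    ... | inj₁ k'<lo = best k' k'<lo ak'
    ... | inj₂ refl = ⊥-elim (true≢false (trans (sym ak') ak))

  SelectsBelow-keep : ∀ {c} → Precedes x c k → SelectsBelow lo x avail (just c) →
                      SelectsBelow (suc lo) x avail (just c)
  SelectsBelow-keep {c} c≼k (c<lo , ac , best) = ℕ.m<n⇒m<1+n c<lo , ac , best′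
    where
    best′ : ∀ k' → toℕ k' < suc lo → avail k' ≡ true → Precedes x c k'
    best′ k' k'<1+lo ak' with below-suc k≡lo k'<1+lo
    ... | inj₁ k'<lo = best k' k'<lo ak'
    ... | inj₂ refl = c≼k

  SelectsBelow-take : avail k ≡ true → (∀ k' → toℕ k' < lo → avail k' ≡ true → Precedes x k k') →
                      SelectsBelow (suc lo) x avail (just k)
  SelectsBelow-take ak best = ℕ.≤-reflexive (cong suc k≡lo) , ak , best′
    where
    best′ : ∀ k' → toℕ k' < suc lo → avail k' ≡ true → Precedes x k k'
    best′ k' k'<1+lo ak' with below-suc k≡lo k'<1+lo
    ... | inj₁ k'<lo = best k' k'<lo ak'
    ... | inj₂ refl = Precedes-refl x k

  -- The comparison x k <? x c unfolds in the goal, so it is resolved by rewriting its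
  -- outcome rather than by abstracting it.
  SelectsBelow-select : ∀ r → SelectsBelow lo x avail r →
                        SelectsBelow (suc lo) x avail (select x avail r k)
  SelectsBelow-select r inv with avail k in ak
  SelectsBelow-select r inv | false = SelectsBelow-skip ak r inv
  SelectsBelow-select nothing none | true =
    SelectsBelow-take ak (λ k' k'<lo ak' → ⊥-elim (true≢false (trans (sym ak') (none k' k'<lo))))
  SelectsBelow-select (just c) inv@(c<lo , _ , best) | true with x k <? x c
  ... | yes xk<xc rewrite dec-true (x k <? x c) xk<xc =
    SelectsBelow-take ak (λ k' k'<lo ak' → <-Precedes-trans xk<xc (best k' k'<lo ak'))
  ... | no xk≮xc rewrite dec-false (x k <? x c) xk≮xc =
    SelectsBelow-keep (inj₂ (ℚ.≮⇒≥ xk≮xc , ℕ.<⇒≤ (subst (toℕ c <_) (sym k≡lo) c<lo))) inv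

SelectsBelow-foldl : ∀ {x : Fin s → ℚ} {avail} {len} lo (g : Fin len → Fin s) →
                     (∀ i → toℕ (g i) ≡ lo + toℕ i) → ∀ r → SelectsBelow lo x avail r →
                     SelectsBelow (lo + len) x avail (foldl (select x avail) r (tabulate g))
SelectsBelow-foldl {x = x} {avail} {ℕ.zero} lo g _ r inv =
  subst (λ hi → SelectsBelow hi x avail r) (sym (ℕ.+-identityʳ lo)) inv
SelectsBelow-foldl {x = x} {avail} {suc len} lo g g≡lo+ r inv =
  subst (λ hi → SelectsBelow hi x avail (foldl (select x avail) (select x avail r (g zero))
                                               (tabulate (g ∘ suc))))
        (sym (ℕ.+-suc lo len))
        (SelectsBelow-foldl (suc lo) (g ∘ suc) (λ i → trans (g≡lo+ (suc i)) (ℕ.+-suc lo (toℕ i))) _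
          (SelectsBelow-select (trans (g≡lo+ zero) (ℕ.+-identityʳ lo)) r inv))

bestSeller-selects : ∀ (x : Fin s → ℚ) avail → Selects x avail (bestSeller x avail)
bestSeller-selects {s} x avail = everywhere _ (SelectsBelow-foldl 0 id (λ _ → refl) nothing (λ _ ()))
  where
  everywhere : ∀ r → SelectsBelow s x avail r → Selects x avail r
  everywhere nothing none k = none k (toℕ<n k)
  everywhere (just c) (_ , ac , best) = ac , λ k → best k (toℕ<n k)

bestSeller≡⇒Selects : ∀ {x : Fin s → ℚ} {avail r} → bestSeller x avail ≡ r → Selects x avail r
bestSeller≡⇒Selects {x = x} {avail} e = subst (Selects x avail) e (bestSeller-selects x avail)

Selects⇒bestSeller≡ : ∀ {x : Fin s → ℚ} {avail} r → Selects x avail r → bestSeller x avail ≡ r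
Selects⇒bestSeller≡ r = Selects-unique _ r (bestSeller-selects _ _)

Selects-≗ : ∀ {x : Fin s → ℚ} {avail avail'} → avail ≗ avail' →
            ∀ r → Selects x avail r → Selects x avail' r
Selects-≗ eq nothing none k = trans (sym (eq k)) (none k)
Selects-≗ eq (just c) (ac , best) = trans (sym (eq c)) ac , λ k ak' → best k (trans (eq k) ak')

bestSeller-cong : ∀ {x : Fin s → ℚ} {avail avail'} → avail ≗ avail' →
                  bestSeller x avail ≡ bestSeller x avail'
bestSeller-cong {x = x} {avail} {avail'} eq =
  sym (Selects⇒bestSeller≡ {avail = avail'} _ (Selects-≗ eq _ (bestSeller-selects x avail)))

_⊆_ : (Fin s → Bool) → (Fin s → Bool) → Set
p ⊆ q = ∀ {k} → p k ≡ true → q k ≡ true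

bestSeller-⊆-nothing : ∀ {x : Fin s → ℚ} {avail avail'} → avail' ⊆ avail →
                       bestSeller x avail ≡ nothing → bestSeller x avail' ≡ nothing
bestSeller-⊆-nothing {x = x} {avail} {avail'} sub e = Selects⇒bestSeller≡ {avail = avail'} nothing none′
  where
  none′ : ∀ k → avail' k ≡ false
  none′ k = ¬-not λ ak' → true≢false (trans (sym (sub ak')) (bestSeller≡⇒Selects {x = x} {avail} e k))

bestSeller-⊆-just : ∀ {x : Fin s → ℚ} {avail avail' c} → avail' ⊆ avail → avail' c ≡ true →
                    bestSeller x avail ≡ just c → bestSeller x avail' ≡ just c
bestSeller-⊆-just {x = x} {avail} {avail'} {c} sub ac' e =
  Selects⇒bestSeller≡ {avail = avail'} (just c) (ac' , best′)
  where
  best′ : ∀ k → avail' k ≡ true → Precedes x c k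
  best′ k ak' = proj₂ (bestSeller≡⇒Selects {x = x} {avail} e) k (sub ak')

data PunchView (j : Fin (suc n)) : Fin (suc n) → Set where
  at-j     : PunchView j j
  punchIn′ : ∀ k → PunchView j (punchIn j k)

punchView : ∀ (j k : Fin (suc n)) → PunchView j k
punchView j k with j ≟ k
... | yes refl = at-j
... | no j≢k = subst (PunchView j) (punchIn-punchOut j≢k) (punchIn′ (punchOut j≢k))

Selects-punchIn : ∀ (j : Fin (suc n)) {x avail} → avail j ≡ false → ∀ r →
                  Selects (x ∘ punchIn j) (avail ∘ punchIn j) r → Selects x avail (mapMaybe (punchIn j) r)
Selects-punchIn j aj nothing none k with punchView j k
... | at-j = aj
... | punchIn′ k' = none k'
Selects-punchIn j {x} {avail} aj (just c) (ac , best) = ac , best′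
  where
  best′ : ∀ k → avail k ≡ true → Precedes x (punchIn j c) k
  best′ k ak with punchView j k
  ... | at-j = ⊥-elim (true≢false (trans (sym ak) aj))
  ... | punchIn′ k' with best k' ak
  ...   | inj₁ xc<xk = inj₁ xc<xk
  ...   | inj₂ (xc≤xk , c≤k) = inj₂ (xc≤xk , punchIn-mono-≤ j c k' c≤k)

bestSeller-punchIn : ∀ (j : Fin (suc n)) {x avail} → avail j ≡ false →
                     bestSeller x avail ≡ mapMaybe (punchIn j) (bestSeller (x ∘ punchIn j) (avail ∘ punchIn j))
bestSeller-punchIn j {x} {avail} aj =
  Selects⇒bestSeller≡ {avail = avail} _
    (Selects-punchIn j aj _ (bestSeller-selects (x ∘ punchIn j) (avail ∘ punchIn j)))

-- The buyer loop of ranking is private to Defs; unification recovers it, so that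
-- run G x m is computes exactly like it, starting from the matched sellers m.
run : Graph s b → (Fin s → ℚ) → (Fin s → Bool) → List (Fin b) → List (Fin b × Fin s)
run {s} {b} G x = loop
  where
  loop : (Fin s → Bool) → List (Fin b) → List (Fin b × Fin s)
  loop = _
  unfolds-ranking : loop (const false) (allFin b) ≡ ranking G x
  unfolds-ranking with allFin b | const {B = Fin s} false
  ... | _ | _ = refl

-- Definitionally equal to the private markMatched of Defs.
mark : (Fin s → Bool) → Fin s → Fin s → Bool
mark m c k = if does (c ≟ k) then true else m k

available : Graph s b → (Fin s → Bool) → Fin b → Fin s → Bool
available G m i k = G i k ∧ not (m k)

mark-self : ∀ (m : Fin s → Bool) c → mark m c c ≡ true
mark-self m c with c ≟ c
... | yes _ = refl
... | no c≢c = ⊥-elim (c≢c refl)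

mark-other : ∀ (m : Fin s → Bool) {c k} → c ≢ k → mark m c k ≡ m k
mark-other m {c} {k} c≢k with c ≟ k
... | yes c≡k = ⊥-elim (c≢k c≡k)
... | no _ = refl

mark-matched : ∀ {m : Fin s → Bool} c {k} → m k ≡ true → mark m c k ≡ true
mark-matched c {k} mk with c ≟ k
... | yes _ = refl
... | no _ = mk

mark-cong : ∀ {m m' : Fin s → Bool} → m ≗ m' → ∀ c → mark m c ≗ mark m' c
mark-cong eq c k with c ≟ k
... | yes _ = refl
... | no _ = eq k

mark-comm : ∀ (m : Fin s → Bool) u c → mark (mark m u) c ≗ mark (mark m c) u
mark-comm m u c k with c ≟ k | u ≟ k
... | yes _ | yes _ = refl
... | yes _ | no _ = refl
... | no _ | yes _ = refl
... | no _ | no _ = refl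

mark-punchIn : ∀ (j : Fin (suc n)) {m m'} → m' ≗ m ∘ punchIn j →
               ∀ c → mark m' c ≗ mark m (punchIn j c) ∘ punchIn j
mark-punchIn j eq c k with c ≟ k | punchIn j c ≟ punchIn j k
... | yes _ | yes _ = refl
... | no _ | no _ = eq k
... | yes refl | no jc≢jk = ⊥-elim (jc≢jk refl)
... | no c≢k | yes jc≡jk = ⊥-elim (c≢k (punchIn-injective j c k jc≡jk))

module _ (G : Graph s b) (i : Fin b) where

  available-cong : ∀ {m m'} → m ≗ m' → available G m i ≗ available G m' i
  available-cong eq k = cong (λ t → G i k ∧ not t) (eq k)

  available-matched : ∀ {m k} → m k ≡ true → available G m i k ≡ false
  available-matched {k = k} mk = trans (cong (λ t → G i k ∧ not t) mk) (∧-zeroʳ (G i k))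

  available-mark-⊆ : ∀ m u → available G (mark m u) i ⊆ available G m i
  available-mark-⊆ m u {k} with u ≟ k
  ... | yes _ = λ ak → ⊥-elim (true≢false (trans (sym ak) (∧-zeroʳ (G i k))))
  ... | no _ = id

  available-mark-≢ : ∀ m {u c} → u ≢ c → available G m i c ≡ true → available G (mark m u) i c ≡ true
  available-mark-≢ m {u} {c} u≢c with u ≟ c
  ... | yes u≡c = ⊥-elim (u≢c u≡c)
  ... | no _ = id

infix 4 _≤_≤_

_≤_≤_ : ℕ → ℕ → ℕ → Set
a ≤ b ≤ c = (a ≤ b) × (b ≤ c)

s≤≤s : ∀ {a b c} → a ≤ b ≤ c → suc a ≤ suc b ≤ suc c
s≤≤s (a≤b , b≤c) = s≤s a≤b , s≤s b≤c

module _ (G : Graph s b) (x : Fin s → ℚ) where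

  run-nothing : ∀ {m i is} → bestSeller x (available G m i) ≡ nothing → run G x m (i ∷ is) ≡ run G x m is
  run-nothing e rewrite e = refl

  run-just : ∀ {m i is c} → bestSeller x (available G m i) ≡ just c →
             run G x m (i ∷ is) ≡ (i , c) ∷ run G x (mark m c) is
  run-just e rewrite e = refl

  run-cong : ∀ {m m'} → m ≗ m' → ∀ is → run G x m is ≡ run G x m' is
  run-cong eq [] = refl
  run-cong {m' = m'} eq (i ∷ is)
    rewrite bestSeller-cong {x = x} (available-cong G i eq) with bestSeller x (available G m' i)
  ... | nothing = run-cong eq is
  ... | just c = cong ((i , c) ∷_) (run-cong (mark-cong eq c) is)

  length-run-mark : ∀ m u is →
    length (run G x (mark m u) is) ≤ length (run G x m is) ≤ length (run G x (mark m u) is) + 1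
  length-run-mark m u [] = z≤n , z≤n
  length-run-mark m u (i ∷ is) with bestSeller x (available G m i) in e
  ... | nothing rewrite bestSeller-⊆-nothing {x = x} (available-mark-⊆ G i m u) e = length-run-mark m u is
  ... | just c with u ≟ c
  ...   | no u≢c
    rewrite bestSeller-⊆-just {x = x} (available-mark-⊆ G i m u)
              (available-mark-≢ G i m u≢c (proj₁ (bestSeller≡⇒Selects {x = x} {available G m i} e))) e =
    s≤≤s (subst (λ ms → length ms ≤ length (run G x (mark m c) is) ≤ length ms + 1)
                (run-cong (mark-comm m c u) is) (length-run-mark (mark m c) u is))
  ...   | yes refl with bestSeller x (available G (mark m u) i)
  ...     | nothing = ℕ.n≤1+n _ , ℕ.≤-reflexive (ℕ.+-comm 1 _)
  ...     | just u′ = s≤≤s (length-run-mark (mark m u) u′ is)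

module _ {n b} (G : Graph (suc n) b) (j : Fin (suc n)) (x : Fin (suc n) → ℚ) where

  bestSeller-deleteSeller : ∀ {m m'} i → m j ≡ true → m' ≗ m ∘ punchIn j →
    bestSeller x (available G m i)
      ≡ mapMaybe (punchIn j) (bestSeller (deleteRank x j) (available (deleteSeller G j) m' i))
  bestSeller-deleteSeller {m} i mj eq =
    trans (bestSeller-punchIn j {x} {available G m i} (available-matched G i {m} mj))
          (cong (mapMaybe (punchIn j))
                (sym (bestSeller-cong {x = deleteRank x j} (available-cong (deleteSeller G j) i eq))))

  run-deleteSeller : ∀ {m m'} → m j ≡ true → m' ≗ m ∘ punchIn j → ∀ is →
    map (map₂ (punchIn j)) (run (deleteSeller G j) (deleteRank x j) m' is) ≡ run G x m is
  run-deleteSeller mj eq [] = refl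
  run-deleteSeller {m} {m'} mj eq (i ∷ is)
    with bestSeller (deleteRank x j) (available (deleteSeller G j) m' i) in e
  ... | nothing = trans (run-deleteSeller mj eq is) (sym (run-nothing G x {m} selection))
    where
    selection : bestSeller x (available G m i) ≡ nothing
    selection = trans (bestSeller-deleteSeller i mj eq) (cong (mapMaybe (punchIn j)) e)
  ... | just c =
    trans (cong ((i , punchIn j c) ∷_)
                (run-deleteSeller (mark-matched {m = m} (punchIn j c) mj) (mark-punchIn j {m} eq c) is))
          (sym (run-just G x {m} selection))
    where
    selection : bestSeller x (available G m i) ≡ just (punchIn j c)
    selection = trans (bestSeller-deleteSeller i mj eq) (cong (mapMaybe (punchIn j)) e)

  ranking-deleteSeller : map (map₂ (punchIn j)) (ranking (deleteSeller G j) (deleteRank x j))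
                         ≡ run G x (mark (const false) j) (allFin b)
  ranking-deleteSeller = run-deleteSeller (mark-self (const false) j) unmatched (allFin b)
    where
    unmatched : const false ≗ mark (const false) j ∘ punchIn j
    unmatched k = sym (mark-other (const false) (punchInᵢ≢i j k ∘ sym))

lemma3 : ∀ {n b} (G : Graph (suc n) b) (j : Fin (suc n)) (x : Fin (suc n) → ℚ) →
    (∀ k → (0ℚ ≤ℚ x k) × (x k ≤ℚ 1ℚ)) →
    (length (ranking (deleteSeller G j) (deleteRank x j)) ≤ length (ranking G x))
    × (length (ranking G x) ≤ length (ranking (deleteSeller G j) (deleteRank x j)) + 1)
lemma3 {b = b} G j x _ =
  subst (λ ℓ → ℓ ≤ length (ranking G x) ≤ ℓ + 1) same-length
        (length-run-mark G x (const false) j (allFin b))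
  where
  same-length : length (run G x (mark (const false) j) (allFin b))
                ≡ length (ranking (deleteSeller G j) (deleteRank x j))
  same-length = trans (cong length (sym (ranking-deleteSeller G j x)))
                      (length-map (map₂ (punchIn j)) (ranking (deleteSeller G j) (deleteRank x j)))
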